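{- Let ${\bf Irr}(z)=\sum_{h\ge0}{\sf Irr}(h)z^h$, where ${\sf Irr}(h)$ is the number of irreducible $3$-noncrossing perfect matchings with $h$ arcs and ${\sf Irr}(0)=1$. Then ${\bf Irr}(z)=2-\frac{1}{{\bf F}_3(z)}$.
   Context: A perfect matching on $[2h]$ is a set of $h$ disjoint arcs $(i,j)$, $i<j$, covering $\{1,\dots,2h\}$. It is $3$-noncrossing if there are no three arcs $(i_1,j_1),(i_2,j_2),(i_3,j_3)$ with $i_1<i_2<i_3<j_1<j_2<j_3$. A nonempty perfect matching on $[2h]$ is irreducible if there is no $\ell\in\{2,\dots,2h\}$ such that every arc $(i,j)$ satisfies $j<\ell$ or $i\ge\ell$. ${\bf F}_3(z)=\sum_{n\ge0}f_3(2n)z^n$, $f_3(2n)$ the number of $3$-noncrossing perfect matchings on $[2n]$. -}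

module Defs where

open import Data.Bool using (Bool; true; false; _∧_; _∨_; not)
open import Data.Nat using (ℕ; zero; suc; _*_; _∸_; _<ᵇ_; _≡ᵇ_)
open import Data.Fin using (Fin; toℕ)
open import Data.Vec using (Vec; []; _∷_; lookup)
open import Data.List using (List; []; _∷_; [_]; map; concatMap; filter; length; foldr; upTo; allFin)
open import Data.Bool.ListAction using (all; any)
open import Data.Integer as ℤ using (ℤ; +_)
open import Relation.Nullary.Decidable using (Dec)
open import Data.Bool.Properties using (T?)

-- A perfect matching on [2n] is encoded by its partner map: a vector
-- m : Vec (Fin (2n)) (2n) with m[x] = partner of x.  Positions are
-- 0-indexed (position x stands for x+1 in [2n]).  The arcs are the
-- pairs (x , m[x]) with x < m[x].

allVecs : (m k : ℕ) → List (Vec (Fin m) k)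
allVecs m zero = [ [] ]
allVecs m (suc k) = concatMap (λ i → map (i ∷_) (allVecs m k)) (allFin m)

module _ {N : ℕ} (v : Vec (Fin N) N) where
  pm : Fin N → Fin N
  pm x = lookup v x

  _<F_ : Fin N → Fin N → Bool
  a <F b = toℕ a <ᵇ toℕ b

  _≡F_ : Fin N → Fin N → Bool
  a ≡F b = toℕ a ≡ᵇ toℕ b

  pts : List (Fin N)
  pts = allFin N

  isPerfectMatching : Bool
  isPerfectMatching = all (λ x → (pm (pm x) ≡F x) ∧ not (pm x ≡F x)) pts

  is3Noncrossing : Bool
  is3Noncrossing = not (any (λ i1 → any (λ i2 → any (λ i3 →
      (i1 <F i2) ∧ (i2 <F i3) ∧ (i3 <F pm i1) ∧ (pm i1 <F pm i2) ∧ (pm i2 <F pm i3))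
      pts) pts) pts)

  -- ℓ (0-indexed cut position, = paper's ℓ - 1) splits the matching if
  -- every arc (i,j) has j < ℓ or i ≥ ℓ
  splitsAt : ℕ → Bool
  splitsAt ℓ = all (λ i → not (i <F pm i) ∨ (toℕ (pm i) <ᵇ ℓ) ∨ not (toℕ i <ᵇ ℓ)) pts

  -- no ℓ in {2,…,2h} (paper, 1-indexed) i.e. ℓ-1 ∈ {1,…,2h-1} splits it
  isIrreducibleCut : Bool
  isIrreducibleCut = not (any (λ ℓ → splitsAt (suc ℓ)) (upTo (N ∸ 1)))

countVec : (N : ℕ) → (Vec (Fin N) N → Bool) → ℕ
countVec N P = length (filter (λ v → T? (P v)) (allVecs N N))

f3 : ℕ → ℕ
f3 n = countVec (2 * n) (λ v → isPerfectMatching v ∧ is3Noncrossing v)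

Irr : ℕ → ℕ
Irr zero = 1
Irr (suc h) = countVec (2 * suc h)
  (λ v → isPerfectMatching v ∧ is3Noncrossing v ∧ isIrreducibleCut v)

Series : Set
Series = ℕ → ℤ

_⊛_ : Series → Series → Series
(a ⊛ b) n = foldr ℤ._+_ (+ 0) (map (λ k → a k ℤ.* b (n ∸ k)) (upTo (suc n)))

one : Series
one zero = + 1
one (suc _) = + 0

two : Series
two zero = + 2
two (suc _) = + 0

IsInverse : Series → Series → Set
IsInverse G F = ∀ n → (G ⊛ F) n ≡ one n
  where open import Relation.Binary.PropositionalEquality using (_≡_)

F3 : Series
F3 n = + f3 n

module Submission where

-- A nonempty 3-noncrossing matching has a least split point ℓ, and cutting there yields an
-- irreducible matching on [1, ℓ] followed by an arbitrary one on the rest: the arc from the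
-- first left end of a 3-crossing covers the other two left ends, so no 3-crossing straddles a split
-- point. Hence f₃(2m+2) = Σ_{i ≤ m} Irr(i+1) f₃(2m−2i), i.e. (2 − Irr)·F₃ = 1, and the inverse of
-- F₃ is unique because its constant term is 1.

open import Defs

open import Data.Bool using (Bool; true; false; T; not; _∧_; _∨_; if_then_else_)
open import Data.Bool.ListAction using (and; or; all; any)
open import Data.Bool.Properties using (T?; T-≡; T-not-≡; T-∧; T-∨; ∧-assoc; ∨-assoc; ∧-identityʳ)
open import Data.Bool.Solver using (module ∨-∧-Solver)
open import Data.Empty using (⊥-elim)
open import Data.Fin using (Fin; toℕ; fromℕ<)
import Data.Fin.Properties as Fin
open import Data.List
  using (List; []; _∷_; [_]; _++_; _∷ʳ_; map; filter; length; foldr; concatMap; upTo; applyUpTo; tabulate; allFin;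
         cartesianProduct; cartesianProductWith)
import Data.List.Properties as List
open import Data.List.Membership.Propositional using (_∈_; find; lose)
open import Data.List.Membership.Propositional.Properties
  using (∈-upTo⁺; ∈-upTo⁻; ∈-allFin; ∈-cartesianProductWith⁺; ∈-cartesianProduct⁺)
import Data.List.Relation.Unary.All as All
open import Data.List.Relation.Unary.All.Properties using (all⁺; all⁻)
open import Data.List.Relation.Unary.AllPairs using ([]; _∷_)
open import Data.List.Relation.Unary.Any using (here; there; _─_)
open import Data.List.Relation.Unary.Any.Properties using (any⁺; any⁻)
open import Data.List.Relation.Unary.Unique.Propositional using (Unique)
import Data.List.Relation.Unary.Unique.Propositional.Properties as Unique
open import Data.Nat
  using (ℕ; zero; suc; _+_; _*_; _∸_; _≤_; _<_; _<ᵇ_; _≡ᵇ_; z≤n; s≤s; z<s; s<s; s<s⁻¹; s≤s⁻¹; _<?_; _≤?_)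
open import Data.Nat.DivMod using (_mod_; _%_; m<n⇒m%n≡m)
open import Data.Nat.ListAction using (sum)
open import Data.Nat.ListAction.Properties using (sum-++)
open import Data.Nat.Properties
open import Algebra.Properties.CommutativeSemigroup +-commutativeSemigroup using (interchange)
open import Data.Product using (∃; _×_; _,_; proj₁; proj₂)
open import Data.Sum using (_⊎_; inj₁; inj₂)
import Data.Sum
open import Data.Vec using (Vec; []; _∷_; lookup)
import Data.Vec as Vec
import Data.Vec.Properties as Vec
open import Function using (_∘_; id)
open import Function.Bundles using (Equivalence)
open import Relation.Binary.PropositionalEquality hiding ([_])
open import Relation.Nullary using (¬_; yes; no)

open ∨-∧-Solver using (solve; _:*_; _:=_)

private
  variable
    A B C D : Set

cong₃ : (f : A → B → C → D) {a a′ : A} {b b′ : B} {c c′ : C} → a ≡ a′ → b ≡ b′ → c ≡ c′ → f a b c ≡ f a′ b′ c′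
cong₃ f refl refl refl = refl

T-ext : {a b : Bool} → (T a → T b) → (T b → T a) → a ≡ b
T-ext {false} {false} _ _ = refl
T-ext {false} {true} _ b⇒a = ⊥-elim (b⇒a _)
T-ext {true} {false} a⇒b _ = ⊥-elim (a⇒b _)
T-ext {true} {true} _ _ = refl

T-not⁻ : {b : Bool} → T (not b) → ¬ T b
T-not⁻ {false} _ ()

<ᵇ-true : {m n : ℕ} → m < n → (m <ᵇ n) ≡ true
<ᵇ-true m<n = Equivalence.to T-≡ (<⇒<ᵇ m<n)

<ᵇ-false : {m n : ℕ} → ¬ m < n → (m <ᵇ n) ≡ false
<ᵇ-false {m} {n} m≮n with m <ᵇ n in eq
... | true = ⊥-elim (m≮n (<ᵇ⇒< m n (subst T (sym eq) _)))
... | false = refl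

+-<ᵇ : (c a b : ℕ) → (c + a <ᵇ c + b) ≡ (a <ᵇ b)
+-<ᵇ zero a b = refl
+-<ᵇ (suc c) a b = +-<ᵇ c a b

+-≡ᵇ : (c a b : ℕ) → (c + a ≡ᵇ c + b) ≡ (a ≡ᵇ b)
+-≡ᵇ zero a b = refl
+-≡ᵇ (suc c) a b = +-≡ᵇ c a b

split-+ : (c M : ℕ) {x : ℕ} → x < c + M → x < c ⊎ ∃ λ y → y < M × x ≡ c + y
split-+ c M {x} x<c+M with x <? c
... | yes x<c = inj₁ x<c
... | no x≮c = inj₂ (x ∸ c , +-cancelˡ-< c _ _ (subst (_< c + M) x≡c+[x∸c] x<c+M) , x≡c+[x∸c])
  where
  x≡c+[x∸c] : x ≡ c + (x ∸ c)
  x≡c+[x∸c] = sym (m+[n∸m]≡n (≮⇒≥ x≮c))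

split-+-≥ : (c M : ℕ) {x : ℕ} → c ≤ x → x < c + M → ∃ λ y → y < M × x ≡ c + y
split-+-≥ c M c≤x x<c+M with split-+ c M x<c+M
... | inj₁ x<c = ⊥-elim (<⇒≱ x<c c≤x)
... | inj₂ y = y

any-++ : (p : A → Bool) (xs ys : List A) → any p (xs ++ ys) ≡ any p xs ∨ any p ys
any-++ p [] ys = refl
any-++ p (x ∷ xs) ys = trans (cong (p x ∨_) (any-++ p xs ys)) (sym (∨-assoc (p x) _ _))

all-++ : (p : A → Bool) (xs ys : List A) → all p (xs ++ ys) ≡ all p xs ∧ all p ys
all-++ p [] ys = refl
all-++ p (x ∷ xs) ys = trans (cong (p x ∧_) (all-++ p xs ys)) (sym (∧-assoc (p x) _ _))

applyUpTo-+ : (f : ℕ → A) (c M : ℕ) → applyUpTo f (c + M) ≡ applyUpTo f c ++ applyUpTo (f ∘ (c +_)) M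
applyUpTo-+ f zero M = refl
applyUpTo-+ f (suc c) M = cong (f 0 ∷_) (applyUpTo-+ (f ∘ suc) c M)

upTo-+ : (c M : ℕ) → upTo (c + M) ≡ upTo c ++ map (c +_) (upTo M)
upTo-+ c M = trans (applyUpTo-+ id c M) (cong (upTo c ++_) (sym (List.map-upTo (c +_) M)))

all-upTo-+ : (p : ℕ → Bool) (c M : ℕ) → all p (upTo (c + M)) ≡ all p (upTo c) ∧ all (p ∘ (c +_)) (upTo M)
all-upTo-+ p c M rewrite upTo-+ c M =
  trans (all-++ p (upTo c) _) (cong (all p (upTo c) ∧_) (cong and (sym (List.map-∘ (upTo M)))))

all-upTo⁻ : (p : ℕ → Bool) {N : ℕ} → T (all p (upTo N)) → ∀ x → x < N → T (p x)
all-upTo⁻ p {N} h x x<N = All.lookup (all⁺ p (upTo N) h) (∈-upTo⁺ x<N)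

all-upTo⁺ : (p : ℕ → Bool) {N : ℕ} → (∀ x → x < N → T (p x)) → T (all p (upTo N))
all-upTo⁺ p h = all⁻ p (All.tabulate (λ x∈ → h _ (∈-upTo⁻ x∈)))

any-upTo⁻ : (p : ℕ → Bool) {N : ℕ} → T (any p (upTo N)) → ∃ λ x → x < N × T (p x)
any-upTo⁻ p {N} h with find (any⁻ p (upTo N) h)
... | x , x∈ , px = x , ∈-upTo⁻ x∈ , px

any-upTo⁺ : (p : ℕ → Bool) {N x : ℕ} → x < N → T (p x) → T (any p (upTo N))
any-upTo⁺ p x<N px = any⁺ p (lose (∈-upTo⁺ x<N) px)

map-upTo-cong : {p q : ℕ → A} (N : ℕ) → (∀ x → x < N → p x ≡ q x) → map p (upTo N) ≡ map q (upTo N)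
map-upTo-cong N p≡q = List.map-cong-local (All.tabulate (λ x∈ → p≡q _ (∈-upTo⁻ x∈)))

all-upTo-cong : {p q : ℕ → Bool} (N : ℕ) → (∀ x → x < N → p x ≡ q x) → all p (upTo N) ≡ all q (upTo N)
all-upTo-cong N p≡q = cong and (map-upTo-cong N p≡q)

any-upTo-cong : {p q : ℕ → Bool} (N : ℕ) → (∀ x → x < N → p x ≡ q x) → any p (upTo N) ≡ any q (upTo N)
any-upTo-cong N p≡q = cong or (map-upTo-cong N p≡q)

tabulate∘toℕ : (N : ℕ) (f : ℕ → A) → tabulate {n = N} (f ∘ toℕ) ≡ applyUpTo f N
tabulate∘toℕ zero f = refl
tabulate∘toℕ (suc N) f = cong (f 0 ∷_) (tabulate∘toℕ N (f ∘ suc))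

map-allFin : (N : ℕ) {p : Fin N → A} (q : ℕ → A) → (∀ i → p i ≡ q (toℕ i)) → map p (allFin N) ≡ map q (upTo N)
map-allFin N {p} q p≡q = begin
  map p (allFin N)      ≡⟨ List.map-tabulate id p ⟩
  tabulate p            ≡⟨ List.tabulate-cong p≡q ⟩
  tabulate (q ∘ toℕ)    ≡⟨ tabulate∘toℕ N q ⟩
  applyUpTo q N         ≡⟨ List.map-upTo q N ⟨
  map q (upTo N)        ∎
  where open ≡-Reasoning

indicator : Bool → ℕ
indicator true = 1
indicator false = 0

count : (A → Bool) → List A → ℕ
count p [] = 0
count p (x ∷ xs) = indicator (p x) + count p xs

length-filter≡count : (p : A → Bool) (xs : List A) → length (filter (T? ∘ p) xs) ≡ count p xs
length-filter≡count p [] = refl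
length-filter≡count p (x ∷ xs) with p x
... | true = cong suc (length-filter≡count p xs)
... | false = length-filter≡count p xs

count-─ : (q : A → Bool) {x : A} {ys : List A} (x∈ : x ∈ ys) → T (q x) →
  count q ys ≡ suc (count q (ys ─ x∈))
count-─ q {ys = y ∷ ys} (here refl) qx with q y
... | true = refl
count-─ q {ys = y ∷ ys} (there x∈) qx =
  trans (cong (indicator (q y) +_) (count-─ q x∈ qx)) (+-suc (indicator (q y)) _)

∈-─ : {x z : A} {ys : List A} (x∈ : x ∈ ys) → z ∈ ys → z ≢ x → z ∈ (ys ─ x∈)
∈-─ (here refl) (here refl) z≢x = ⊥-elim (z≢x refl)
∈-─ (here refl) (there z∈) z≢x = z∈
∈-─ (there x∈) (here refl) z≢x = here refl
∈-─ (there x∈) (there z∈) z≢x = there (∈-─ x∈ z∈ z≢x)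

Embedding : (A → Bool) → List A → (B → Bool) → List B → (A → B) → (B → A) → Set
Embedding p xs q ys f g = ∀ x → x ∈ xs → T (p x) → T (q (f x)) × f x ∈ ys × g (f x) ≡ x

count-mono : (p : A → Bool) (q : B → Bool) (f : A → B) (g : B → A) {xs : List A} {ys : List B} →
  Unique xs → Embedding p xs q ys f g → count p xs ≤ count q ys
count-mono p q f g {xs = []} _ _ = z≤n
count-mono p q f g {x ∷ xs} {ys} (x∉xs ∷ uxs) emb with p x in px
... | false = count-mono p q f g uxs (λ z z∈ → emb z (there z∈))
... | true with emb x (here refl) (subst T (sym px) _)
... | qfx , fx∈ , gfx≡x = begin
  suc (count p xs)            ≤⟨ s≤s (count-mono p q f g uxs emb′) ⟩
  suc (count q (ys ─ fx∈))    ≡⟨ count-─ q fx∈ qfx ⟨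
  count q ys                  ∎
  where
  open ≤-Reasoning
  emb′ : Embedding p xs q (ys ─ fx∈) f g
  emb′ z z∈ pz with emb z (there z∈) pz
  ... | qfz , fz∈ , gfz≡z = qfz , ∈-─ fx∈ fz∈ fz≢fx , gfz≡z
    where
    fz≢fx : f z ≢ f x
    fz≢fx fz≡fx = All.lookup x∉xs z∈ (trans (sym gfx≡x) (trans (cong g (sym fz≡fx)) gfz≡z))

count-bijection : (p : A → Bool) (q : B → Bool) (f : A → B) (g : B → A) {xs : List A} {ys : List B} →
  Unique xs → Unique ys → Embedding p xs q ys f g → Embedding q ys p xs g f →
  count p xs ≡ count q ys
count-bijection p q f g uxs uys f-emb g-emb =
  ≤-antisym (count-mono p q f g uxs f-emb) (count-mono q p g f uys g-emb)

count-cong : {p q : A → Bool} (xs : List A) → (∀ x → x ∈ xs → p x ≡ q x) → count p xs ≡ count q xs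
count-cong [] _ = refl
count-cong (x ∷ xs) p≡q = cong₂ _+_ (cong indicator (p≡q x (here refl))) (count-cong xs (λ y y∈ → p≡q y (there y∈)))

count-none : {p : A → Bool} (xs : List A) → (∀ x → ¬ T (p x)) → count p xs ≡ 0
count-none {p = p} [] _ = refl
count-none {p = p} (x ∷ xs) ¬p with p x | ¬p x
... | true | ¬px = ⊥-elim (¬px _)
... | false | _ = count-none xs ¬p

count+count-not : (p : A → Bool) (xs : List A) → count p xs + count (not ∘ p) xs ≡ length xs
count+count-not p [] = refl
count+count-not p (x ∷ xs) with p x
... | true = cong suc (count+count-not p xs)
... | false = trans (+-suc (count p xs) _) (cong suc (count+count-not p xs))

count-++ : (p : A → Bool) (xs ys : List A) → count p (xs ++ ys) ≡ count p xs + count p ys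
count-++ p [] ys = refl
count-++ p (x ∷ xs) ys = trans (cong (indicator (p x) +_) (count-++ p xs ys)) (sym (+-assoc (indicator (p x)) _ _))

count-map : (p : B → Bool) (f : A → B) (xs : List A) → count p (map f xs) ≡ count (p ∘ f) xs
count-map p f [] = refl
count-map p f (x ∷ xs) = cong (indicator (p (f x)) +_) (count-map p f xs)

count-cartesianProduct : (p : A → Bool) (q : B → Bool) (xs : List A) (ys : List B) →
  count (λ xy → p (proj₁ xy) ∧ q (proj₂ xy)) (cartesianProduct xs ys) ≡ count p xs * count q ys
count-cartesianProduct p q [] ys = refl
count-cartesianProduct p q (x ∷ xs) ys = begin
  count _ (map (x ,_) ys ++ cartesianProduct xs ys)
    ≡⟨ count-++ _ (map (x ,_) ys) _ ⟩
  count _ (map (x ,_) ys) + count _ (cartesianProduct xs ys)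
    ≡⟨ cong₂ _+_ (trans (count-map _ (x ,_) ys) (row (p x))) (count-cartesianProduct p q xs ys) ⟩
  indicator (p x) * count q ys + count p xs * count q ys
    ≡⟨ *-distribʳ-+ (count q ys) (indicator (p x)) (count p xs) ⟨
  count p (x ∷ xs) * count q ys ∎
  where
  open ≡-Reasoning
  row : (b : Bool) → count (λ y → b ∧ q y) ys ≡ indicator b * count q ys
  row true = sym (+-identityʳ _)
  row false = count-none ys (λ _ ())

∑< : ℕ → (ℕ → ℕ) → ℕ
∑< n g = sum (applyUpTo g n)

infix 5 ∑<
syntax ∑< n (λ j → e) = ∑[ j < n ] e

∑-cong : (n : ℕ) {g h : ℕ → ℕ} → (∀ j → j < n → g j ≡ h j) → ∑< n g ≡ ∑< n h
∑-cong zero _ = refl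
∑-cong (suc n) g≡h = cong₂ _+_ (g≡h 0 z<s) (∑-cong n (λ j j<n → g≡h (suc j) (s<s j<n)))

∑-zero : (n : ℕ) → ∑[ j < n ] 0 ≡ 0
∑-zero zero = refl
∑-zero (suc n) = ∑-zero n

∑-+ : (n : ℕ) (g h : ℕ → ℕ) → ∑[ j < n ] (g j + h j) ≡ ∑< n g + ∑< n h
∑-+ zero g h = refl
∑-+ (suc n) g h = trans (cong (g 0 + h 0 +_) (∑-+ n (g ∘ suc) (h ∘ suc))) (interchange (g 0) (h 0) _ _)

∑-last : (n : ℕ) (g : ℕ → ℕ) → ∑< (suc n) g ≡ ∑< n g + g n
∑-last n g = begin
  sum (applyUpTo g (suc n))     ≡⟨ cong sum (List.applyUpTo-∷ʳ g n) ⟨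
  sum (applyUpTo g n ∷ʳ g n)    ≡⟨ sum-++ (applyUpTo g n) [ g n ] ⟩
  ∑< n g + (g n + 0)            ≡⟨ cong (∑< n g +_) (+-identityʳ (g n)) ⟩
  ∑< n g + g n                  ∎
  where open ≡-Reasoning

∑-odd : (m : ℕ) (g : ℕ → ℕ) → (∀ i → g (i + i) ≡ 0) → ∑< (m + m) g ≡ ∑[ i < m ] g (suc (i + i))
∑-odd zero g _ = refl
∑-odd (suc m) g g-even≡0 = begin
  ∑< (suc m + suc m) g                          ≡⟨ cong (λ k → ∑< (suc k) g) (+-suc m m) ⟩
  ∑< (suc (suc (m + m))) g                      ≡⟨ ∑-last (suc (m + m)) g ⟩
  ∑< (suc (m + m)) g + g (suc (m + m))          ≡⟨ cong (_+ g (suc (m + m))) (∑-last (m + m) g) ⟩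
  ∑< (m + m) g + g (m + m) + g (suc (m + m))    ≡⟨ cong (λ x → ∑< (m + m) g + x + g (suc (m + m))) (g-even≡0 m) ⟩
  ∑< (m + m) g + 0 + g (suc (m + m))            ≡⟨ cong (λ x → x + 0 + g (suc (m + m))) (∑-odd m g g-even≡0) ⟩
  (∑[ i < m ] g (suc (i + i))) + 0 + g (suc (m + m))
                                                ≡⟨ cong (_+ g (suc (m + m))) (+-identityʳ _) ⟩
  (∑[ i < m ] g (suc (i + i))) + g (suc (m + m))  ≡⟨ ∑-last m (λ i → g (suc (i + i))) ⟨
  ∑[ i < suc m ] g (suc (i + i))                ∎
  where open ≡-Reasoning

∑-first≡any : (t : ℕ → Bool) (m : ℕ) →
  ∑[ j < m ] indicator (t j ∧ not (any t (upTo j))) ≡ indicator (any t (upTo m))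
∑-first≡any t zero = refl
∑-first≡any t (suc m) = begin
  ∑[ j < suc m ] indicator (t j ∧ not (any t (upTo j)))
    ≡⟨ ∑-last m _ ⟩
  (∑[ j < m ] indicator (t j ∧ not (any t (upTo j)))) + indicator (t m ∧ not (any t (upTo m)))
    ≡⟨ cong (_+ indicator (t m ∧ not (any t (upTo m)))) (∑-first≡any t m) ⟩
  indicator (any t (upTo m)) + indicator (t m ∧ not (any t (upTo m)))
    ≡⟨ step (any t (upTo m)) (t m) ⟩
  indicator (any t (upTo m) ∨ (t m ∨ false))
    ≡⟨ cong indicator (any-++ t (upTo m) [ m ]) ⟨
  indicator (any t (upTo m ∷ʳ m))
    ≡⟨ cong (indicator ∘ any t) (List.upTo-∷ʳ m) ⟩
  indicator (any t (upTo (suc m)))  ∎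
  where
  open ≡-Reasoning
  step : (a b : Bool) → indicator a + indicator (b ∧ not a) ≡ indicator (a ∨ (b ∨ false))
  step true true = refl
  step true false = refl
  step false true = refl
  step false false = refl

count-partition : (p : A → Bool) (r : ℕ → A → Bool) (m : ℕ) (xs : List A) →
  (∀ x → T (p x) → ∑[ j < m ] indicator (r j x) ≡ 1) →
  count p xs ≡ ∑[ j < m ] count (λ x → p x ∧ r j x) xs
count-partition p r m [] _ = sym (∑-zero m)
count-partition p r m (x ∷ xs) unique-class = begin
  indicator (p x) + count p xs
    ≡⟨ cong₂ _+_ (head (p x) refl) (count-partition p r m xs unique-class) ⟩
  (∑[ j < m ] indicator (p x ∧ r j x)) + (∑[ j < m ] count (λ y → p y ∧ r j y) xs)
    ≡⟨ ∑-+ m _ _ ⟨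
  ∑[ j < m ] count (λ y → p y ∧ r j y) (x ∷ xs)  ∎
  where
  open ≡-Reasoning
  head : (b : Bool) → p x ≡ b → indicator b ≡ ∑[ j < m ] indicator (b ∧ r j x)
  head true px = sym (unique-class x (subst T (sym px) _))
  head false _ = sym (∑-zero m)

allVecs-suc : (m k : ℕ) → allVecs m (suc k) ≡ cartesianProductWith _∷_ (allFin m) (allVecs m k)
allVecs-suc m k = go (allFin m)
  where
  go : (is : List (Fin m)) → concatMap (λ i → map (i ∷_) (allVecs m k)) is ≡ cartesianProductWith _∷_ is (allVecs m k)
  go [] = refl
  go (i ∷ is) = cong (map (i ∷_) (allVecs m k) ++_) (go is)

allVecs-unique : (m k : ℕ) → Unique (allVecs m k)
allVecs-unique m zero = All.[] ∷ []
allVecs-unique m (suc k) rewrite allVecs-suc m k =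
  Unique.cartesianProductWith⁺ _∷_ Vec.∷-injective (Unique.allFin⁺ m) (allVecs-unique m k)

∈-allVecs : {m k : ℕ} (v : Vec (Fin m) k) → v ∈ allVecs m k
∈-allVecs {m} {zero} [] = here refl
∈-allVecs {m} {suc k} (i ∷ v) rewrite allVecs-suc m k =
  ∈-cartesianProductWith⁺ _∷_ (∈-allFin i) (∈-allVecs v)

MapsBelow : ℕ → (ℕ → ℕ) → Set
MapsBelow N F = ∀ {x} → x < N → F x < N

EqualBelow : ℕ → (ℕ → ℕ) → (ℕ → ℕ) → Set
EqualBelow N F G = ∀ {x} → x < N → F x ≡ G x

-- Matchings are handled through their partner maps on ℕ, so that cutting and gluing need no
-- Fin arithmetic; lookupℕ is 0 outside the index range.
lookupℕ : {M K : ℕ} → Vec (Fin M) K → ℕ → ℕ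
lookupℕ [] x = 0
lookupℕ (a ∷ as) zero = toℕ a
lookupℕ (a ∷ as) (suc x) = lookupℕ as x

lookupℕ-toℕ : {M K : ℕ} (v : Vec (Fin M) K) (i : Fin K) → lookupℕ v (toℕ i) ≡ toℕ (lookup v i)
lookupℕ-toℕ (a ∷ v) Fin.zero = refl
lookupℕ-toℕ (a ∷ v) (Fin.suc i) = lookupℕ-toℕ v i

lookupℕ-< : {M K : ℕ} (v : Vec (Fin M) K) {x : ℕ} → x < K → lookupℕ v x < M
lookupℕ-< (a ∷ v) {zero} _ = Fin.toℕ<n a
lookupℕ-< (a ∷ v) {suc x} x<K = lookupℕ-< v (s<s⁻¹ x<K)

lookupℕ-injective : {M K : ℕ} (v w : Vec (Fin M) K) → (∀ x → x < K → lookupℕ v x ≡ lookupℕ w x) → v ≡ w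
lookupℕ-injective [] [] _ = refl
lookupℕ-injective (a ∷ v) (b ∷ w) v≡w =
  cong₂ _∷_ (Fin.toℕ-injective (v≡w 0 z<s)) (lookupℕ-injective v w (λ x x<K → v≡w (suc x) (s<s x<K)))

tabulateℕ : (N : ℕ) → (ℕ → ℕ) → Vec (Fin N) N
tabulateℕ zero F = []
tabulateℕ N@(suc _) F = Vec.tabulate (λ i → F (toℕ i) mod N)

lookupℕ-tabulateℕ : (N : ℕ) (F : ℕ → ℕ) {x : ℕ} → x < N → F x < N → lookupℕ (tabulateℕ N F) x ≡ F x
lookupℕ-tabulateℕ N@(suc _) F {x} x<N Fx<N = begin
  lookupℕ (tabulateℕ N F) x                  ≡⟨ cong (lookupℕ (tabulateℕ N F)) (Fin.toℕ-fromℕ< x<N) ⟨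
  lookupℕ (tabulateℕ N F) (toℕ i)            ≡⟨ lookupℕ-toℕ (tabulateℕ N F) i ⟩
  toℕ (lookup (tabulateℕ N F) i)             ≡⟨ cong toℕ (Vec.lookup∘tabulate (λ j → F (toℕ j) mod N) i) ⟩
  toℕ (F (toℕ i) mod N)                      ≡⟨ Fin.toℕ-fromℕ< _ ⟩
  F (toℕ i) % N                              ≡⟨ cong (λ y → F y % N) (Fin.toℕ-fromℕ< x<N) ⟩
  F x % N                                    ≡⟨ m<n⇒m%n≡m Fx<N ⟩
  F x                                        ∎
  where
  open ≡-Reasoning
  i = fromℕ< x<N

lookupℕ-tabulateℕ-≗ : {N : ℕ} {F G : ℕ → ℕ} → MapsBelow N G → EqualBelow N F G →
  EqualBelow N (lookupℕ (tabulateℕ N F)) G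
lookupℕ-tabulateℕ-≗ {N} {F} G↓ F≡G x<N =
  trans (lookupℕ-tabulateℕ N F x<N (subst (_< N) (sym (F≡G x<N)) (G↓ x<N))) (F≡G x<N)

isPerfectMatchingℕ : ℕ → (ℕ → ℕ) → Bool
isPerfectMatchingℕ N F = all (λ x → (F (F x) ≡ᵇ x) ∧ not (F x ≡ᵇ x)) (upTo N)

crosses3 : (ℕ → ℕ) → ℕ → ℕ → ℕ → Bool
crosses3 F a b e = (a <ᵇ b) ∧ (b <ᵇ e) ∧ (e <ᵇ F a) ∧ (F a <ᵇ F b) ∧ (F b <ᵇ F e)

has3Crossing : ℕ → (ℕ → ℕ) → Bool
has3Crossing N F = any (λ a → any (λ b → any (λ e → crosses3 F a b e) (upTo N)) (upTo N)) (upTo N)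

splitsAtℕ : ℕ → (ℕ → ℕ) → ℕ → Bool
splitsAtℕ N F ℓ = all (λ i → not (i <ᵇ F i) ∨ (F i <ᵇ ℓ) ∨ not (i <ᵇ ℓ)) (upTo N)

splitsBelow : ℕ → (ℕ → ℕ) → ℕ → Bool
splitsBelow N F c = any (λ ℓ → splitsAtℕ N F (suc ℓ)) (upTo (c ∸ 1))

isIrreducibleℕ : ℕ → (ℕ → ℕ) → Bool
isIrreducibleℕ N F = not (splitsBelow N F N)

isFirstCut : ℕ → (ℕ → ℕ) → ℕ → Bool
isFirstCut N F c = splitsAtℕ N F c ∧ not (splitsBelow N F c)

isMatching : ℕ → (ℕ → ℕ) → Bool
isMatching N F = isPerfectMatchingℕ N F ∧ not (has3Crossing N F)

isIrreducibleMatching : ℕ → (ℕ → ℕ) → Bool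
isIrreducibleMatching N F = isPerfectMatchingℕ N F ∧ not (has3Crossing N F) ∧ isIrreducibleℕ N F

countMatchings : ℕ → ℕ
countMatchings N = count (isMatching N ∘ lookupℕ) (allVecs N N)

countIrreducible : ℕ → ℕ
countIrreducible N = count (isIrreducibleMatching N ∘ lookupℕ) (allVecs N N)

module _ {N : ℕ} (v : Vec (Fin N) N) where
  private
    F = lookupℕ v

    pm≡F : ∀ i → toℕ (pm v i) ≡ F (toℕ i)
    pm≡F i = sym (lookupℕ-toℕ v i)

    pm²≡F² : ∀ i → toℕ (pm v (pm v i)) ≡ F (F (toℕ i))
    pm²≡F² i = trans (pm≡F (pm v i)) (cong F (pm≡F i))

    all-allFin : {p : Fin N → Bool} (q : ℕ → Bool) → (∀ i → p i ≡ q (toℕ i)) → all p (allFin N) ≡ all q (upTo N)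
    all-allFin q p≡q = cong and (map-allFin N q p≡q)

    any-allFin : {p : Fin N → Bool} (q : ℕ → Bool) → (∀ i → p i ≡ q (toℕ i)) → any p (allFin N) ≡ any q (upTo N)
    any-allFin q p≡q = cong or (map-allFin N q p≡q)

  isPerfectMatching-lookupℕ : isPerfectMatching v ≡ isPerfectMatchingℕ N F
  isPerfectMatching-lookupℕ = all-allFin _ λ i →
    cong₂ (λ a b → (a ≡ᵇ toℕ i) ∧ not (b ≡ᵇ toℕ i)) (pm²≡F² i) (pm≡F i)

  is3Noncrossing-lookupℕ : is3Noncrossing v ≡ not (has3Crossing N F)
  is3Noncrossing-lookupℕ = cong not (any-allFin _ λ i → any-allFin _ λ j → any-allFin _ λ k →
    cong₃ (λ a b e → (toℕ i <ᵇ toℕ j) ∧ (toℕ j <ᵇ toℕ k) ∧ (toℕ k <ᵇ a) ∧ (a <ᵇ b) ∧ (b <ᵇ e))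
      (pm≡F i) (pm≡F j) (pm≡F k))

  splitsAt-lookupℕ : ∀ ℓ → splitsAt v ℓ ≡ splitsAtℕ N F ℓ
  splitsAt-lookupℕ ℓ = all-allFin _ λ i →
    cong (λ a → not (toℕ i <ᵇ a) ∨ (a <ᵇ ℓ) ∨ not (toℕ i <ᵇ ℓ)) (pm≡F i)

  isIrreducibleCut-lookupℕ : isIrreducibleCut v ≡ isIrreducibleℕ N F
  isIrreducibleCut-lookupℕ = cong not (cong or (List.map-cong (splitsAt-lookupℕ ∘ suc) (upTo (N ∸ 1))))

f3≡countMatchings : ∀ n → f3 n ≡ countMatchings (2 * n)
f3≡countMatchings n = trans (length-filter≡count _ (allVecs (2 * n) (2 * n)))
  (count-cong (allVecs (2 * n) (2 * n)) λ v _ →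
    cong₂ _∧_ (isPerfectMatching-lookupℕ v) (is3Noncrossing-lookupℕ v))

Irr≡countIrreducible : ∀ h → Irr (suc h) ≡ countIrreducible (2 * suc h)
Irr≡countIrreducible h = trans (length-filter≡count _ (allVecs (2 * suc h) (2 * suc h)))
  (count-cong (allVecs (2 * suc h) (2 * suc h)) λ v _ →
    cong₂ _∧_ (isPerfectMatching-lookupℕ v) (cong₂ _∧_ (is3Noncrossing-lookupℕ v) (isIrreducibleCut-lookupℕ v)))

isPerfectMatchingℕ⁻ : {N : ℕ} {F : ℕ → ℕ} → T (isPerfectMatchingℕ N F) → ∀ {x} → x < N → F (F x) ≡ x × F x ≢ x
isPerfectMatchingℕ⁻ {N} {F} perfect {x} x<N with Equivalence.to T-∧ (all-upTo⁻ _ perfect x x<N)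
... | FFx≡x , Fx≢x = ≡ᵇ⇒≡ _ _ FFx≡x , λ Fx≡x → T-not⁻ Fx≢x (≡⇒≡ᵇ _ _ Fx≡x)

splitsAtℕ⁻ : {N : ℕ} {F : ℕ → ℕ} {ℓ i : ℕ} → T (splitsAtℕ N F ℓ) → i < N → i < F i → F i < ℓ ⊎ ℓ ≤ i
splitsAtℕ⁻ {F = F} {ℓ} {i} split i<N i<Fi with all-upTo⁻ _ split i i<N
... | arc-ok rewrite <ᵇ-true i<Fi with Equivalence.to T-∨ arc-ok
... | inj₁ Fi<ℓ = inj₁ (<ᵇ⇒< _ _ Fi<ℓ)
... | inj₂ i≮ℓ = inj₂ (≮⇒≥ (λ i<ℓ → T-not⁻ i≮ℓ (<⇒<ᵇ i<ℓ)))

splitsAtℕ-top : {N : ℕ} {F : ℕ → ℕ} → MapsBelow N F → T (splitsAtℕ N F N)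
splitsAtℕ-top {N} {F} F↓ = all-upTo⁺ _ λ x x<N →
  Equivalence.from (T-∨ {not (x <ᵇ F x)}) (inj₂ (Equivalence.from (T-∨ {F x <ᵇ N}) (inj₁ (<⇒<ᵇ (F↓ x<N)))))

isPerfectMatchingℕ-cong : {N : ℕ} {F G : ℕ → ℕ} → MapsBelow N F → EqualBelow N F G →
  isPerfectMatchingℕ N F ≡ isPerfectMatchingℕ N G
isPerfectMatchingℕ-cong {N} {F} {G} F↓ F≡G = all-upTo-cong N λ x x<N →
  cong₂ (λ a b → (a ≡ᵇ x) ∧ not (b ≡ᵇ x)) (trans (F≡G (F↓ x<N)) (cong G (F≡G x<N))) (F≡G x<N)

crosses3-cong : {F G : ℕ → ℕ} {a b e : ℕ} → F a ≡ G a → F b ≡ G b → F e ≡ G e →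
  crosses3 F a b e ≡ crosses3 G a b e
crosses3-cong {a = a} {b} {e} = cong₃ (λ u v w → (a <ᵇ b) ∧ (b <ᵇ e) ∧ (e <ᵇ u) ∧ (u <ᵇ v) ∧ (v <ᵇ w))

has3Crossing-cong : {N : ℕ} {F G : ℕ → ℕ} → EqualBelow N F G → has3Crossing N F ≡ has3Crossing N G
has3Crossing-cong {N} {F} {G} F≡G =
  any-upTo-cong N λ a a<N → any-upTo-cong N λ b b<N → any-upTo-cong N λ e e<N →
    crosses3-cong {F} {G} (F≡G a<N) (F≡G b<N) (F≡G e<N)

splitsAtℕ-cong : {N : ℕ} {F G : ℕ → ℕ} → EqualBelow N F G → ∀ ℓ → splitsAtℕ N F ℓ ≡ splitsAtℕ N G ℓ
splitsAtℕ-cong {N} F≡G ℓ = all-upTo-cong N λ i i<N →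
  cong (λ a → not (i <ᵇ a) ∨ (a <ᵇ ℓ) ∨ not (i <ᵇ ℓ)) (F≡G i<N)

splitsBelow-cong : {N : ℕ} {F G : ℕ → ℕ} → EqualBelow N F G → ∀ c → splitsBelow N F c ≡ splitsBelow N G c
splitsBelow-cong F≡G c = cong or (List.map-cong (splitsAtℕ-cong F≡G ∘ suc) (upTo (c ∸ 1)))

isMatching-cong : {N : ℕ} {F G : ℕ → ℕ} → MapsBelow N F → EqualBelow N F G → isMatching N F ≡ isMatching N G
isMatching-cong F↓ F≡G = cong₂ _∧_ (isPerfectMatchingℕ-cong F↓ F≡G) (cong not (has3Crossing-cong F≡G))

isIrreducibleMatching-cong : {N : ℕ} {F G : ℕ → ℕ} → MapsBelow N F → EqualBelow N F G →
  isIrreducibleMatching N F ≡ isIrreducibleMatching N G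
isIrreducibleMatching-cong {N} F↓ F≡G = cong₃ (λ p x s → p ∧ not x ∧ not s)
  (isPerfectMatchingℕ-cong F↓ F≡G) (has3Crossing-cong F≡G) (splitsBelow-cong F≡G N)

isFirstCut-cong : {N : ℕ} {F G : ℕ → ℕ} → EqualBelow N F G → ∀ c → isFirstCut N F c ≡ isFirstCut N G c
isFirstCut-cong F≡G c = cong₂ (λ s b → s ∧ not b) (splitsAtℕ-cong F≡G c) (splitsBelow-cong F≡G c)

crosses3-shift : (c : ℕ) {F G : ℕ → ℕ} {a b e : ℕ} → (∀ y → F (c + y) ≡ c + G y) →
  crosses3 F (c + a) (c + b) (c + e) ≡ crosses3 G a b e
crosses3-shift c {F} {G} {a} {b} {e} F≡c+G rewrite F≡c+G a | F≡c+G b | F≡c+G e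
  | +-<ᵇ c a b | +-<ᵇ c b e | +-<ᵇ c e (G a) | +-<ᵇ c (G a) (G b) | +-<ᵇ c (G b) (G e) = refl

record Crossing3 (N : ℕ) (F : ℕ → ℕ) : Set where
  constructor crossing3
  field
    {a b e} : ℕ
    a<N : a < N
    b<N : b < N
    e<N : e < N
    crosses : T (crosses3 F a b e)

has3Crossing⁻ : {N : ℕ} {F : ℕ → ℕ} → T (has3Crossing N F) → Crossing3 N F
has3Crossing⁻ h with any-upTo⁻ _ h
... | a , a<N , ha with any-upTo⁻ _ ha
... | b , b<N , hb with any-upTo⁻ _ hb
... | e , e<N , he = crossing3 a<N b<N e<N he

has3Crossing⁺ : {N : ℕ} {F : ℕ → ℕ} → Crossing3 N F → T (has3Crossing N F)
has3Crossing⁺ (crossing3 a<N b<N e<N t) = any-upTo⁺ _ a<N (any-upTo⁺ _ b<N (any-upTo⁺ _ e<N t))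

crosses3⁻ : {F : ℕ → ℕ} {a b e : ℕ} → T (crosses3 F a b e) → a < b × b < e × e < F a
crosses3⁻ t with Equivalence.to T-∧ t
... | a<b , t′ with Equivalence.to T-∧ t′
... | b<e , t″ = <ᵇ⇒< _ _ a<b , <ᵇ⇒< _ _ b<e , <ᵇ⇒< _ _ (proj₁ (Equivalence.to T-∧ t″))

_++⟨_⟩_ : (ℕ → ℕ) → ℕ → (ℕ → ℕ) → ℕ → ℕ
(F ++⟨ c ⟩ G) x = if x <ᵇ c then F x else c + G (x ∸ c)

rightPart : ℕ → (ℕ → ℕ) → ℕ → ℕ
rightPart c F y = F (c + y) ∸ c

module _ (F : ℕ → ℕ) (c : ℕ) (G : ℕ → ℕ) where

  ++⟨⟩-< : {x : ℕ} → x < c → (F ++⟨ c ⟩ G) x ≡ F x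
  ++⟨⟩-< x<c rewrite <ᵇ-true x<c = refl

  ++⟨⟩-+ : (y : ℕ) → (F ++⟨ c ⟩ G) (c + y) ≡ c + G y
  ++⟨⟩-+ y rewrite <ᵇ-false (m+n≮m c y) | m+n∸m≡n c y = refl

  rightPart-++⟨⟩ : (y : ℕ) → rightPart c (F ++⟨ c ⟩ G) y ≡ G y
  rightPart-++⟨⟩ y = trans (cong (_∸ c) (++⟨⟩-+ y)) (m+n∸m≡n c (G y))

++⟨⟩-cong : {c M : ℕ} {F F′ G G′ : ℕ → ℕ} → EqualBelow c F F′ → EqualBelow M G G′ →
  EqualBelow (c + M) (F ++⟨ c ⟩ G) (F′ ++⟨ c ⟩ G′)
++⟨⟩-cong {c} {M} {F} {F′} {G} {G′} F≡F′ G≡G′ x<c+M with split-+ c M x<c+M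
... | inj₁ x<c = trans (++⟨⟩-< F c G x<c) (trans (F≡F′ x<c) (sym (++⟨⟩-< F′ c G′ x<c)))
... | inj₂ (y , y<M , refl) = trans (++⟨⟩-+ F c G y) (trans (cong (c +_) (G≡G′ y<M)) (sym (++⟨⟩-+ F′ c G′ y)))

module Juxtaposition {c M : ℕ} {F G : ℕ → ℕ} (F↓ : MapsBelow c F) (G↓ : MapsBelow M G) where

  private
    H = F ++⟨ c ⟩ G

  ++⟨⟩-mapsBelow : MapsBelow (c + M) H
  ++⟨⟩-mapsBelow x<c+M with split-+ c M x<c+M
  ... | inj₁ x<c = subst (_< c + M) (sym (++⟨⟩-< F c G x<c)) (≤-trans (F↓ x<c) (m≤m+n c M))
  ... | inj₂ (y , y<M , refl) = subst (_< c + M) (sym (++⟨⟩-+ F c G y)) (+-monoʳ-< c (G↓ y<M))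

  isPerfectMatchingℕ-++⟨⟩ : isPerfectMatchingℕ (c + M) H ≡ isPerfectMatchingℕ c F ∧ isPerfectMatchingℕ M G
  isPerfectMatchingℕ-++⟨⟩ = trans (all-upTo-+ _ c M) (cong₂ _∧_ (all-upTo-cong c left) (all-upTo-cong M right))
    where
    left : ∀ x → x < c → ((H (H x) ≡ᵇ x) ∧ not (H x ≡ᵇ x)) ≡ ((F (F x) ≡ᵇ x) ∧ not (F x ≡ᵇ x))
    left x x<c = cong₂ (λ a b → (a ≡ᵇ x) ∧ not (b ≡ᵇ x))
      (trans (cong H (++⟨⟩-< F c G x<c)) (++⟨⟩-< F c G (F↓ x<c))) (++⟨⟩-< F c G x<c)
    right : ∀ y → y < M → ((H (H (c + y)) ≡ᵇ c + y) ∧ not (H (c + y) ≡ᵇ c + y)) ≡ ((G (G y) ≡ᵇ y) ∧ not (G y ≡ᵇ y))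
    right y _ = trans
      (cong₂ (λ a b → (a ≡ᵇ c + y) ∧ not (b ≡ᵇ c + y)) (trans (cong H (++⟨⟩-+ F c G y)) (++⟨⟩-+ F c G (G y))) (++⟨⟩-+ F c G y))
      (cong₂ (λ a b → a ∧ not b) (+-≡ᵇ c (G (G y)) y) (+-≡ᵇ c (G y) y))

  crosses3-++⟨⟩ˡ : {a b e : ℕ} → a < c → b < c → e < c → crosses3 H a b e ≡ crosses3 F a b e
  crosses3-++⟨⟩ˡ a<c b<c e<c = crosses3-cong {H} {F} (++⟨⟩-< F c G a<c) (++⟨⟩-< F c G b<c) (++⟨⟩-< F c G e<c)

  crosses3-++⟨⟩ʳ : (a b e : ℕ) → crosses3 H (c + a) (c + b) (c + e) ≡ crosses3 G a b e
  crosses3-++⟨⟩ʳ a b e = crosses3-shift c {H} {G} {a} {b} {e} (++⟨⟩-+ F c G)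

  -- The arc (a, H a) stays in the block of a and covers b and e, so the whole crossing does.
  crossing-++⟨⟩⁻ : Crossing3 (c + M) H → Crossing3 c F ⊎ Crossing3 M G
  crossing-++⟨⟩⁻ (crossing3 {a} {b} {e} a< b< e< t) with crosses3⁻ {H} {a} {b} {e} t | split-+ c M a<
  ... | a<b , b<e , e<Ha | inj₁ a<c = inj₁ (crossing3 a<c b<c e<c (subst T (crosses3-++⟨⟩ˡ {a} {b} {e} a<c b<c e<c) t))
    where
    e<c = <-trans e<Ha (subst (_< c) (sym (++⟨⟩-< F c G a<c)) (F↓ a<c))
    b<c = <-trans b<e e<c
  ... | a<b , b<e , _ | inj₂ (a′ , a′<M , refl)
    with split-+-≥ c M {b} (≤-trans (m≤m+n c a′) (<⇒≤ a<b)) b<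
       | split-+-≥ c M {e} (≤-trans (m≤m+n c a′) (<⇒≤ (<-trans a<b b<e))) e<
  ... | b′ , b′<M , refl | e′ , e′<M , refl =
    inj₂ (crossing3 a′<M b′<M e′<M (subst T (crosses3-++⟨⟩ʳ a′ b′ e′) t))

  crossing-++⟨⟩⁺ : Crossing3 c F ⊎ Crossing3 M G → Crossing3 (c + M) H
  crossing-++⟨⟩⁺ (inj₁ (crossing3 a<c b<c e<c t)) =
    crossing3 (<-≤-trans a<c (m≤m+n c M)) (<-≤-trans b<c (m≤m+n c M)) (<-≤-trans e<c (m≤m+n c M))
      (subst T (sym (crosses3-++⟨⟩ˡ a<c b<c e<c)) t)
  crossing-++⟨⟩⁺ (inj₂ (crossing3 {a} {b} {e} a<M b<M e<M t)) =
    crossing3 (+-monoʳ-< c a<M) (+-monoʳ-< c b<M) (+-monoʳ-< c e<M) (subst T (sym (crosses3-++⟨⟩ʳ a b e)) t)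

  has3Crossing-++⟨⟩ : has3Crossing (c + M) H ≡ has3Crossing c F ∨ has3Crossing M G
  has3Crossing-++⟨⟩ = T-ext
    (λ h → Equivalence.from T-∨ (Data.Sum.map has3Crossing⁺ has3Crossing⁺ (crossing-++⟨⟩⁻ (has3Crossing⁻ h))))
    (λ h → has3Crossing⁺ (crossing-++⟨⟩⁺ (Data.Sum.map has3Crossing⁻ has3Crossing⁻ (Equivalence.to T-∨ h))))

  splitsAtℕ-++⟨⟩ : {d : ℕ} → d ≤ c → splitsAtℕ (c + M) H d ≡ splitsAtℕ c F d
  splitsAtℕ-++⟨⟩ {d} d≤c = begin
    splitsAtℕ (c + M) H d                                     ≡⟨ all-upTo-+ _ c M ⟩
    splitsAtℕ c H d ∧ all (arcOK d ∘ (c +_)) (upTo M)          ≡⟨ cong₂ _∧_ (splitsAtℕ-cong (++⟨⟩-< F c G) d) right ⟩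
    splitsAtℕ c F d ∧ true                                    ≡⟨ ∧-identityʳ _ ⟩
    splitsAtℕ c F d                                           ∎
    where
    open ≡-Reasoning
    arcOK : ℕ → ℕ → Bool
    arcOK ℓ i = not (i <ᵇ H i) ∨ (H i <ᵇ ℓ) ∨ not (i <ᵇ ℓ)
    right : all (arcOK d ∘ (c +_)) (upTo M) ≡ true
    right = Equivalence.to T-≡ (all-upTo⁺ (arcOK d ∘ (c +_)) {M} λ y _ →
      subst (λ b → T (not (c + y <ᵇ H (c + y)) ∨ (H (c + y) <ᵇ d) ∨ not b))
            (sym (<ᵇ-false (λ c+y<d → <⇒≱ c+y<d (≤-trans d≤c (m≤m+n c y)))))
            (Equivalence.from (T-∨ {not (c + y <ᵇ H (c + y))}) (inj₂ (Equivalence.from (T-∨ {H (c + y) <ᵇ d}) (inj₂ _)))))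

  isFirstCut-++⟨⟩ : isFirstCut (c + M) H c ≡ isIrreducibleℕ c F
  isFirstCut-++⟨⟩ = cong₂ (λ s b → s ∧ not b)
    (trans (splitsAtℕ-++⟨⟩ ≤-refl) (Equivalence.to T-≡ (splitsAtℕ-top F↓)))
    (any-upTo-cong (c ∸ 1) λ ℓ ℓ<c∸1 → splitsAtℕ-++⟨⟩ (≤-trans ℓ<c∸1 (m∸n≤m c 1)))

  isMatching-++⟨⟩-isFirstCut :
    isMatching (c + M) H ∧ isFirstCut (c + M) H c ≡ isIrreducibleMatching c F ∧ isMatching M G
  isMatching-++⟨⟩-isFirstCut = begin
    (isPerfectMatchingℕ (c + M) H ∧ not (has3Crossing (c + M) H)) ∧ isFirstCut (c + M) H c
      ≡⟨ cong₃ (λ p x f → (p ∧ not x) ∧ f) isPerfectMatchingℕ-++⟨⟩ has3Crossing-++⟨⟩ isFirstCut-++⟨⟩ ⟩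
    ((pmF ∧ pmG) ∧ not (crF ∨ crG)) ∧ isIrreducibleℕ c F
      ≡⟨ cong (λ x → ((pmF ∧ pmG) ∧ x) ∧ isIrreducibleℕ c F) (not-∨ crF crG) ⟩
    ((pmF ∧ pmG) ∧ (not crF ∧ not crG)) ∧ isIrreducibleℕ c F
      ≡⟨ shuffle pmF pmG (not crF) (not crG) (isIrreducibleℕ c F) ⟩
    (pmF ∧ not crF ∧ isIrreducibleℕ c F) ∧ (pmG ∧ not crG)  ∎
    where
    open ≡-Reasoning
    pmF = isPerfectMatchingℕ c F
    pmG = isPerfectMatchingℕ M G
    crF = has3Crossing c F
    crG = has3Crossing M G
    not-∨ : (a b : Bool) → not (a ∨ b) ≡ not a ∧ not b
    not-∨ false b = refl
    not-∨ true b = refl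
    shuffle : ∀ a b c d e → ((a ∧ b) ∧ (c ∧ d)) ∧ e ≡ (a ∧ c ∧ e) ∧ (b ∧ d)
    shuffle = solve 5 (λ a b c d e → ((a :* b) :* (c :* d)) :* e := (a :* (c :* e)) :* (b :* d)) refl

module Restriction {c M : ℕ} {F : ℕ → ℕ} (F↓ : MapsBelow (c + M) F)
  (perfect : T (isPerfectMatchingℕ (c + M) F)) (split : T (splitsAtℕ (c + M) F c)) where

  private
    involutive : {x : ℕ} → x < c + M → F (F x) ≡ x
    involutive x<c+M = proj₁ (isPerfectMatchingℕ⁻ {c + M} {F} perfect x<c+M)

    arc-beside-cut : {i : ℕ} → i < c + M → i < F i → F i < c ⊎ c ≤ i
    arc-beside-cut = splitsAtℕ⁻ {c + M} {F} {c} split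

  left↓ : MapsBelow c F
  left↓ {x} x<c with x <? F x
  ... | no x≮Fx = ≤-<-trans (≮⇒≥ x≮Fx) x<c
  ... | yes x<Fx with arc-beside-cut (<-≤-trans x<c (m≤m+n c M)) x<Fx
  ... | inj₁ Fx<c = Fx<c
  ... | inj₂ c≤x = ⊥-elim (<⇒≱ x<c c≤x)

  -- If the partner w of c + y were below c, the arc (w, c + y) would cross the cut.
  right≥ : {y : ℕ} → y < M → c ≤ F (c + y)
  right≥ {y} y<M with c ≤? F (c + y)
  ... | yes c≤w = c≤w
  ... | no c≰w with arc-beside-cut (F↓ c+y<c+M) (subst (F (c + y) <_) (sym (involutive c+y<c+M)) w<c+y)
    where
    c+y<c+M = +-monoʳ-< c y<M
    w<c+y = <-≤-trans (≰⇒> c≰w) (m≤m+n c y)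
  ... | inj₁ Fw<c = ⊥-elim (<⇒≱ Fw<c (subst (c ≤_) (sym (involutive (+-monoʳ-< c y<M))) (m≤m+n c y)))
  ... | inj₂ c≤w = ⊥-elim (c≰w c≤w)

  right↓ : MapsBelow M (rightPart c F)
  right↓ {y} y<M = +-cancelˡ-< c _ _
    (subst (_< c + M) (sym (m+[n∸m]≡n (right≥ y<M))) (F↓ (+-monoʳ-< c y<M)))

  ++⟨⟩-rightPart : EqualBelow (c + M) (F ++⟨ c ⟩ rightPart c F) F
  ++⟨⟩-rightPart x<c+M with split-+ c M x<c+M
  ... | inj₁ x<c = ++⟨⟩-< F c (rightPart c F) x<c
  ... | inj₂ (y , y<M , refl) = trans (++⟨⟩-+ F c (rightPart c F) y) (m+[n∸m]≡n (right≥ y<M))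

-- Every matching on [0, N) with N > 0 splits at N, hence has exactly one least cut.
∑-isFirstCut≡1 : {N : ℕ} {F : ℕ → ℕ} → MapsBelow (suc N) F →
  ∑[ j < suc N ] indicator (isFirstCut (suc N) F (suc j)) ≡ 1
∑-isFirstCut≡1 {N} {F} F↓ = trans (∑-first≡any (splitsAtℕ (suc N) F ∘ suc) (suc N))
  (cong indicator (Equivalence.to T-≡ (any-upTo⁺ (splitsAtℕ (suc N) F ∘ suc) {suc N} {N} ≤-refl (splitsAtℕ-top F↓))))

-- F exchanges the left ends x < F x of the arcs with their right ends.
isPerfectMatchingℕ⇒even : {N : ℕ} {F : ℕ → ℕ} → MapsBelow N F → T (isPerfectMatchingℕ N F) → ∃ λ k → N ≡ k + k
isPerfectMatchingℕ⇒even {N} {F} F↓ perfect = count isLeftEnd (upTo N) , (begin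
  N                                                        ≡⟨ List.length-upTo N ⟨
  length (upTo N)                                          ≡⟨ count+count-not isLeftEnd (upTo N) ⟨
  count isLeftEnd (upTo N) + count (not ∘ isLeftEnd) (upTo N)
    ≡⟨ cong (count isLeftEnd (upTo N) +_) (trans (count-cong (upTo N) rightEnd) (sym leftEnds≡rightEnds)) ⟩
  count isLeftEnd (upTo N) + count isLeftEnd (upTo N)      ∎)
  where
  open ≡-Reasoning
  isLeftEnd : ℕ → Bool
  isLeftEnd x = x <ᵇ F x
  isRightEnd : ℕ → Bool
  isRightEnd x = F x <ᵇ x
  involutive : ∀ {x} → x < N → F (F x) ≡ x
  involutive x<N = proj₁ (isPerfectMatchingℕ⁻ {N} {F} perfect x<N)
  swap : {p q : ℕ → Bool} → (∀ {x} → x < N → p x ≡ q (F x)) → Embedding p (upTo N) q (upTo N) F F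
  swap p≡q∘F x x∈ px = subst T (p≡q∘F (∈-upTo⁻ x∈)) px , ∈-upTo⁺ (F↓ (∈-upTo⁻ x∈)) , involutive (∈-upTo⁻ x∈)
  leftEnds≡rightEnds : count isLeftEnd (upTo N) ≡ count isRightEnd (upTo N)
  leftEnds≡rightEnds = count-bijection isLeftEnd isRightEnd F F (Unique.upTo⁺ N) (Unique.upTo⁺ N)
    (swap {isLeftEnd} {isRightEnd} λ {x} x<N → cong (_<ᵇ F x) (sym (involutive x<N)))
    (swap {isRightEnd} {isLeftEnd} λ {x} x<N → cong (F x <ᵇ_) (sym (involutive x<N)))
  rightEnd : ∀ x → x ∈ upTo N → not (isLeftEnd x) ≡ isRightEnd x
  rightEnd x x∈ = T-ext
    (λ x≮Fx → <⇒<ᵇ (≤∧≢⇒< (≮⇒≥ (T-not⁻ {x <ᵇ F x} x≮Fx ∘ <⇒<ᵇ)) (proj₂ (isPerfectMatchingℕ⁻ {N} {F} perfect (∈-upTo⁻ x∈)))))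
    (λ Fx<x → Equivalence.from T-not-≡ (<ᵇ-false {x} {F x} (<⇒≯ (<ᵇ⇒< (F x) x Fx<x))))

odd≢even : ∀ n k → suc (n + n) ≢ k + k
odd≢even zero (suc k) 1≡k+k with trans (suc-injective 1≡k+k) (+-suc k k)
... | ()
odd≢even (suc n) (suc k) e = odd≢even n k (suc-injective (suc-injective (begin
  suc (suc (suc (n + n)))   ≡⟨ cong (suc ∘ suc) (+-suc n n) ⟨
  suc (suc n + suc n)       ≡⟨ e ⟩
  suc k + suc k             ≡⟨ cong suc (+-suc k k) ⟩
  suc (suc (k + k))         ∎)))
  where open ≡-Reasoning

countIrreducible-odd : ∀ n → countIrreducible (suc (n + n)) ≡ 0
countIrreducible-odd n = count-none (allVecs (suc (n + n)) (suc (n + n))) λ v v-ok →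
  let (k , odd≡k+k) = isPerfectMatchingℕ⇒even (lookupℕ-< v) (proj₁ (Equivalence.to T-∧ v-ok))
  in odd≢even n k odd≡k+k

-- Cutting at the first cut c is a bijection onto (irreducible on [0, c)) × (any on [c, c + M)).
module FirstCutDecomposition (c M : ℕ) where

  private
    N = c + M

    matchingWithFirstCut : Vec (Fin N) N → Bool
    matchingWithFirstCut v = isMatching N (lookupℕ v) ∧ isFirstCut N (lookupℕ v) c

    isBlockPair : Vec (Fin c) c × Vec (Fin M) M → Bool
    isBlockPair ab = isIrreducibleMatching c (lookupℕ (proj₁ ab)) ∧ isMatching M (lookupℕ (proj₂ ab))

    cut : Vec (Fin N) N → Vec (Fin c) c × Vec (Fin M) M
    cut v = tabulateℕ c (lookupℕ v) , tabulateℕ M (rightPart c (lookupℕ v))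

    glue : Vec (Fin c) c × Vec (Fin M) M → Vec (Fin N) N
    glue (a , b) = tabulateℕ N (lookupℕ a ++⟨ c ⟩ lookupℕ b)

    cut-embedding : Embedding matchingWithFirstCut (allVecs N N) isBlockPair (cartesianProduct (allVecs c c) (allVecs M M)) cut glue
    cut-embedding v _ v-ok = subst T (sym pair≡v) v-ok , ∈-cartesianProduct⁺ (∈-allVecs a) (∈-allVecs b) , glue∘cut
      where
      F = lookupℕ v
      F↓ = lookupℕ-< v
      perfect : T (isPerfectMatchingℕ N F)
      perfect = proj₁ (Equivalence.to (T-∧ {isPerfectMatchingℕ N F}) (proj₁ (Equivalence.to (T-∧ {isMatching N F}) v-ok)))
      splitsAtCut : T (splitsAtℕ N F c)
      splitsAtCut = proj₁ (Equivalence.to (T-∧ {splitsAtℕ N F c}) (proj₂ (Equivalence.to (T-∧ {isMatching N F}) v-ok)))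
      open Restriction {c} {M} F↓ perfect splitsAtCut
      open Juxtaposition {c} {M} left↓ right↓
      a = tabulateℕ c F
      b = tabulateℕ M (rightPart c F)
      A≡F : EqualBelow c (lookupℕ a) F
      A≡F = lookupℕ-tabulateℕ-≗ left↓ λ _ → refl
      B≡R : EqualBelow M (lookupℕ b) (rightPart c F)
      B≡R = lookupℕ-tabulateℕ-≗ right↓ λ _ → refl
      pair≡v : isBlockPair (a , b) ≡ matchingWithFirstCut v
      pair≡v = begin
        isBlockPair (a , b)
          ≡⟨ cong₂ _∧_ (isIrreducibleMatching-cong (lookupℕ-< a) A≡F) (isMatching-cong (lookupℕ-< b) B≡R) ⟩
        isIrreducibleMatching c F ∧ isMatching M (rightPart c F)
          ≡⟨ isMatching-++⟨⟩-isFirstCut ⟨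
        isMatching N (F ++⟨ c ⟩ rightPart c F) ∧ isFirstCut N (F ++⟨ c ⟩ rightPart c F) c
          ≡⟨ cong₂ _∧_ (isMatching-cong ++⟨⟩-mapsBelow ++⟨⟩-rightPart) (isFirstCut-cong ++⟨⟩-rightPart c) ⟩
        matchingWithFirstCut v  ∎
        where open ≡-Reasoning
      glue∘cut : glue (a , b) ≡ v
      glue∘cut = lookupℕ-injective _ v λ x x<N →
        lookupℕ-tabulateℕ-≗ F↓ (λ x<N → trans (++⟨⟩-cong A≡F B≡R x<N) (++⟨⟩-rightPart x<N)) x<N

    glue-embedding : Embedding isBlockPair (cartesianProduct (allVecs c c) (allVecs M M)) matchingWithFirstCut (allVecs N N) glue cut
    glue-embedding (a , b) _ ab-ok = subst T (sym w≡pair) ab-ok , ∈-allVecs w , cut∘glue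
      where
      F = lookupℕ a
      G = lookupℕ b
      open Juxtaposition {c} {M} (lookupℕ-< a) (lookupℕ-< b)
      H = F ++⟨ c ⟩ G
      w = glue (a , b)
      W≡H : EqualBelow N (lookupℕ w) H
      W≡H = lookupℕ-tabulateℕ-≗ ++⟨⟩-mapsBelow λ _ → refl
      w≡pair : matchingWithFirstCut w ≡ isBlockPair (a , b)
      w≡pair = trans (cong₂ _∧_ (isMatching-cong (lookupℕ-< w) W≡H) (isFirstCut-cong W≡H c)) isMatching-++⟨⟩-isFirstCut
      cut∘glue : cut w ≡ (a , b)
      cut∘glue = cong₂ _,_
        (lookupℕ-injective _ a λ x x<c → lookupℕ-tabulateℕ-≗ (lookupℕ-< a)
          (λ x<c → trans (W≡H (<-≤-trans x<c (m≤m+n c M))) (++⟨⟩-< F c G x<c)) x<c)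
        (lookupℕ-injective _ b λ y y<M → lookupℕ-tabulateℕ-≗ (lookupℕ-< b)
          (λ {y} y<M → trans (cong (_∸ c) (W≡H (+-monoʳ-< c y<M))) (rightPart-++⟨⟩ F c G y)) y<M)

  count-isFirstCut : count matchingWithFirstCut (allVecs N N) ≡ countIrreducible c * countMatchings M
  count-isFirstCut = trans
    (count-bijection matchingWithFirstCut isBlockPair cut glue (allVecs-unique N N)
      (Unique.cartesianProduct⁺ (allVecs-unique c c) (allVecs-unique M M)) cut-embedding glue-embedding)
    (count-cartesianProduct (isIrreducibleMatching c ∘ lookupℕ) (isMatching M ∘ lookupℕ) (allVecs c c) (allVecs M M))

countMatchings-suc : ∀ N → countMatchings (suc N) ≡ ∑[ j < suc N ] countIrreducible (suc j) * countMatchings (N ∸ j)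
countMatchings-suc N =
  trans (count-partition _ (λ j v → isFirstCut (suc N) (lookupℕ v) (suc j)) (suc N) (allVecs (suc N) (suc N))
          (λ v _ → ∑-isFirstCut≡1 (lookupℕ-< v)))
        (∑-cong (suc N) block)
  where
  block : ∀ j → j < suc N →
    count (λ v → isMatching (suc N) (lookupℕ v) ∧ isFirstCut (suc N) (lookupℕ v) (suc j)) (allVecs (suc N) (suc N))
      ≡ countIrreducible (suc j) * countMatchings (N ∸ j)
  block j j<1+N rewrite sym (m+[n∸m]≡n (s≤s⁻¹ j<1+N)) | m+n∸m≡n j (N ∸ j) =
    FirstCutDecomposition.count-isFirstCut (suc j) (N ∸ j)

countMatchings-even : ∀ m →
  countMatchings (2 * suc m) ≡ ∑[ i < suc m ] countIrreducible (2 * suc i) * countMatchings (2 * (m ∸ i))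
countMatchings-even m = begin
  -- 2 * suc m unfolds to suc (m + suc (m + 0))
  countMatchings (2 * suc m)            ≡⟨ countMatchings-suc (m + suc (m + 0)) ⟩
  ∑< (2 * suc m) g                      ≡⟨ cong (λ k → ∑< (suc m + k) g) (+-identityʳ (suc m)) ⟩
  ∑< (suc m + suc m) g                  ≡⟨ ∑-odd (suc m) g (λ i → cong (_* countMatchings (m + suc (m + 0) ∸ (i + i))) (countIrreducible-odd i)) ⟩
  ∑[ i < suc m ] g (suc (i + i))        ≡⟨ ∑-cong (suc m) (λ i _ → cong₂ _*_ (cong countIrreducible (2+i+i i)) (cong countMatchings (size i))) ⟩
  ∑[ i < suc m ] countIrreducible (2 * suc i) * countMatchings (2 * (m ∸ i))  ∎
  where
  open ≡-Reasoning
  g : ℕ → ℕ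
  g j = countIrreducible (suc j) * countMatchings (m + suc (m + 0) ∸ j)
  i+i : ∀ i → i + i ≡ 2 * i
  i+i i = cong (i +_) (sym (+-identityʳ i))
  2+i+i : ∀ i → suc (suc (i + i)) ≡ 2 * suc i
  2+i+i i = cong suc (trans (cong suc (i+i i)) (sym (+-suc i (i + 0))))
  size : ∀ i → m + suc (m + 0) ∸ suc (i + i) ≡ 2 * (m ∸ i)
  size i = begin
    m + suc (m + 0) ∸ suc (i + i)  ≡⟨ cong₂ _∸_ (+-suc m (m + 0)) (cong suc (i+i i)) ⟩
    2 * m ∸ 2 * i                  ≡⟨ *-distribˡ-∸ 2 m i ⟨
    2 * (m ∸ i)                    ∎

f3-suc : ∀ m → f3 (suc m) ≡ ∑[ i < suc m ] Irr (suc i) * f3 (m ∸ i)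
f3-suc m = begin
  f3 (suc m)                                                              ≡⟨ f3≡countMatchings (suc m) ⟩
  countMatchings (2 * suc m)                                              ≡⟨ countMatchings-even m ⟩
  ∑[ i < suc m ] countIrreducible (2 * suc i) * countMatchings (2 * (m ∸ i))
    ≡⟨ ∑-cong (suc m) (λ i _ → sym (cong₂ _*_ (Irr≡countIrreducible i) (f3≡countMatchings (m ∸ i)))) ⟩
  ∑[ i < suc m ] Irr (suc i) * f3 (m ∸ i)                                 ∎
  where open ≡-Reasoning

-- Imported only here: with ℤ's prefix +_ in scope, ℕ sections such as (c +_) are ambiguous.
open import Data.Integer as ℤ using (ℤ; +_; _-_)
import Data.Integer.Properties as ℤ
open import Data.Integer.Tactic.RingSolver using (solve-∀)
open import Algebra.Properties.AbelianGroup ℤ.+-0-abelianGroup using (∙-cancelˡ)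
open import Data.Nat.Induction using (<-rec)

∑ℤ< : ℕ → (ℕ → ℤ) → ℤ
∑ℤ< n g = foldr ℤ._+_ (+ 0) (applyUpTo g n)

infix 5 ∑ℤ<
syntax ∑ℤ< n (λ k → e) = ∑ℤ[ k < n ] e

⊛-∑ℤ : (a b : Series) (n : ℕ) → (a ⊛ b) n ≡ ∑ℤ[ k < suc n ] a k ℤ.* b (n ∸ k)
⊛-∑ℤ a b n = cong (foldr ℤ._+_ (+ 0)) (List.map-upTo (λ k → a k ℤ.* b (n ∸ k)) (suc n))

∑ℤ-last : (n : ℕ) (g : ℕ → ℤ) → ∑ℤ< (suc n) g ≡ ∑ℤ< n g ℤ.+ g n
∑ℤ-last zero g = ℤ.+-comm (g 0) (+ 0)
∑ℤ-last (suc n) g = trans (cong (λ x → g 0 ℤ.+ x) (∑ℤ-last n (g ∘ suc))) (sym (ℤ.+-assoc (g 0) _ _))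

∑ℤ-cong : (n : ℕ) {g h : ℕ → ℤ} → (∀ k → k < n → g k ≡ h k) → ∑ℤ< n g ≡ ∑ℤ< n h
∑ℤ-cong zero _ = refl
∑ℤ-cong (suc n) g≡h = cong₂ ℤ._+_ (g≡h 0 z<s) (∑ℤ-cong n (λ k k<n → g≡h (suc k) (s<s k<n)))

∑ℤ-neg : (n : ℕ) (g : ℕ → ℤ) → ∑ℤ[ k < n ] ℤ.- g k ≡ ℤ.- ∑ℤ< n g
∑ℤ-neg zero g = refl
∑ℤ-neg (suc n) g = trans (cong (λ x → ℤ.- g 0 ℤ.+ x) (∑ℤ-neg n (g ∘ suc))) (sym (ℤ.neg-distrib-+ (g 0) _))

+-∑ : (n : ℕ) (g : ℕ → ℕ) → + ∑< n g ≡ ∑ℤ[ k < n ] + g k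
+-∑ zero g = refl
+-∑ (suc n) g = trans (ℤ.pos-+ (g 0) _) (cong (λ x → + g 0 ℤ.+ x) (+-∑ n (g ∘ suc)))

⊛-last : (G F : Series) → F 0 ≡ + 1 → ∀ n → (G ⊛ F) n ≡ (∑ℤ[ k < n ] G k ℤ.* F (n ∸ k)) ℤ.+ G n
⊛-last G F F0≡1 n = begin
  (G ⊛ F) n                           ≡⟨ ⊛-∑ℤ G F n ⟩
  ∑ℤ[ k < suc n ] G k ℤ.* F (n ∸ k)   ≡⟨ ∑ℤ-last n (λ k → G k ℤ.* F (n ∸ k)) ⟩
  S ℤ.+ G n ℤ.* F (n ∸ n)             ≡⟨ cong (λ x → S ℤ.+ G n ℤ.* F x) (n∸n≡0 n) ⟩
  S ℤ.+ G n ℤ.* F 0                   ≡⟨ cong (λ x → S ℤ.+ G n ℤ.* x) F0≡1 ⟩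
  S ℤ.+ G n ℤ.* + 1                   ≡⟨ cong (λ x → S ℤ.+ x) (ℤ.*-identityʳ (G n)) ⟩
  S ℤ.+ G n                           ∎
  where
  open ≡-Reasoning
  S = ∑ℤ[ k < n ] G k ℤ.* F (n ∸ k)

⊛-cancelʳ : {F G H : Series} → F 0 ≡ + 1 → (∀ n → (G ⊛ F) n ≡ (H ⊛ F) n) → ∀ n → G n ≡ H n
⊛-cancelʳ {F} {G} {H} F0≡1 G⊛F≡H⊛F = <-rec (λ n → G n ≡ H n) step
  where
  open ≡-Reasoning
  step : ∀ n → (∀ {k} → k < n → G k ≡ H k) → G n ≡ H n
  step n G≡H-below = ∙-cancelˡ (lower H) (G n) (H n) (begin
    lower H ℤ.+ G n   ≡⟨ cong (λ x → x ℤ.+ G n) lowerG≡lowerH ⟨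
    lower G ℤ.+ G n   ≡⟨ ⊛-last G F F0≡1 n ⟨
    (G ⊛ F) n         ≡⟨ G⊛F≡H⊛F n ⟩
    (H ⊛ F) n         ≡⟨ ⊛-last H F F0≡1 n ⟩
    lower H ℤ.+ H n   ∎)
    where
    lower : Series → ℤ
    lower K = ∑ℤ[ k < n ] K k ℤ.* F (n ∸ k)
    lowerG≡lowerH : lower G ≡ lower H
    lowerG≡lowerH = ∑ℤ-cong n λ k k<n → cong (λ x → x ℤ.* F (n ∸ k)) (G≡H-below k<n)

twoMinusIrr : Series
twoMinusIrr h = two h - + Irr h

twoMinusIrr⊛F3 : ∀ n → (twoMinusIrr ⊛ F3) n ≡ one n
twoMinusIrr⊛F3 zero = refl
twoMinusIrr⊛F3 (suc m) = begin
  (twoMinusIrr ⊛ F3) (suc m)                          ≡⟨ ⊛-∑ℤ twoMinusIrr F3 (suc m) ⟩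
  twoMinusIrr 0 ℤ.* F3 (suc m) ℤ.+ tail               ≡⟨ cong (λ x → twoMinusIrr 0 ℤ.* F3 (suc m) ℤ.+ x) tail≡-F3 ⟩
  twoMinusIrr 0 ℤ.* F3 (suc m) ℤ.+ ℤ.- F3 (suc m)     ≡⟨ cancel (F3 (suc m)) ⟩
  + 0                                                 ∎
  where
  open ≡-Reasoning
  tail : ℤ
  tail = ∑ℤ[ i < suc m ] twoMinusIrr (suc i) ℤ.* F3 (m ∸ i)
  term : ℕ → ℕ
  term i = Irr (suc i) * f3 (m ∸ i)
  negate-product : ∀ a b → (+ 0 - + a) ℤ.* + b ≡ ℤ.- + (a * b)
  negate-product a b = trans (neg-* (+ a) (+ b)) (cong ℤ.-_ (sym (ℤ.pos-* a b)))
    where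
    neg-* : ∀ (x y : ℤ) → (+ 0 - x) ℤ.* y ≡ ℤ.- (x ℤ.* y)
    neg-* = solve-∀
  tail≡-F3 : tail ≡ ℤ.- F3 (suc m)
  tail≡-F3 = begin
    tail                                    ≡⟨ ∑ℤ-cong (suc m) (λ i _ → negate-product (Irr (suc i)) (f3 (m ∸ i))) ⟩
    (∑ℤ[ i < suc m ] ℤ.- + term i)          ≡⟨ ∑ℤ-neg (suc m) (λ i → + term i) ⟩
    ℤ.- (∑ℤ[ i < suc m ] + term i)          ≡⟨ cong ℤ.-_ (+-∑ (suc m) term) ⟨
    ℤ.- + ∑< (suc m) term                   ≡⟨ cong (ℤ.-_ ∘ +_) (f3-suc m) ⟨
    ℤ.- F3 (suc m)                          ∎
  cancel : ∀ (x : ℤ) → (+ 2 - + 1) ℤ.* x ℤ.+ ℤ.- x ≡ + 0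
  cancel = solve-∀

lemma4p2 : (invF3 : Series) → IsInverse invF3 F3 →
    ∀ h → + Irr h ≡ two h - invF3 h
lemma4p2 invF3 invF3⊛F3≡1 h = begin
  + Irr h                  ≡⟨ double-negation (two h) (+ Irr h) ⟩
  two h - twoMinusIrr h    ≡⟨ cong (two h -_) (⊛-cancelʳ {F3} {twoMinusIrr} {invF3} refl twoMinusIrr⊛F3≡invF3⊛F3 h) ⟩
  two h - invF3 h          ∎
  where
  open ≡-Reasoning
  twoMinusIrr⊛F3≡invF3⊛F3 : ∀ n → (twoMinusIrr ⊛ F3) n ≡ (invF3 ⊛ F3) n
  twoMinusIrr⊛F3≡invF3⊛F3 n = trans (twoMinusIrr⊛F3 n) (sym (invF3⊛F3≡1 n))
  double-negation : ∀ (t x : ℤ) → x ≡ t - (t - x)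
  double-negation = solve-∀
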